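{- Let $n \geq 1$ and let $N \geq 2^{2n}+1$ be a rational integer. Let $\underline{a} = (a_1, \dots, a_n) \in \mathbb{Z}^n$ be a non-zero integer vector with $\gcd(a_1, \dots, a_n, N) = 1$. Set $S_{\underline{a}} = \mathbb{Z}\underline{a} + N\mathbb{Z}^n \subset \mathbb{Z}^n$ and, for $R>0$, $B_R = \{x \in \mathbb{R}^n : |x|_\infty \leq R\}$. Then $S_{\underline{a}} \cap B_{N^{1-\frac{1}{2n}}}$ contains a non-zero vector.
   Context: $|\cdot|_\infty$ denotes the max-norm on $\mathbb{R}^n$. -}

module Defs where

open import Data.Nat using (ℕ; _*_; _^_; _≤_; _∸_)
open import Data.Nat.GCD using (gcd)
open import Data.Integer as ℤ using (ℤ; ∣_∣)
open import Data.Fin using (Fin)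
open import Data.Vec.Functional using (Vector; foldr)
open import Data.Product using (∃; ∃₂; _×_)
open import Relation.Binary.PropositionalEquality using (_≡_; _≢_)

gcdWith : {n : ℕ} → Vector ℤ n → ℕ → ℕ
gcdWith a N = foldr (λ z g → gcd ∣ z ∣ g) N a

InS : {n : ℕ} → Vector ℤ n → ℕ → Vector ℤ n → Set
InS a N x = ∃₂ λ (k : ℤ) (y : Vector ℤ _) →
  ∀ i → x i ≡ (k ℤ.* a i) ℤ.+ (ℤ.+ N ℤ.* y i)

NonZeroVec : {n : ℕ} → Vector ℤ n → Set
NonZeroVec x = ∃ λ i → x i ≢ ℤ.0ℤ

-- x ∈ B_{N^{1 - 1/(2n)}} (max-norm ball), i.e. |xᵢ| ≤ N^{(2n-1)/(2n)} for all i,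
-- expressed without reals by raising both (nonnegative) sides to the power 2n:
-- |xᵢ|^{2n} ≤ N^{2n-1}.
InBall : (n : ℕ) → ℕ → Vector ℤ n → Set
InBall n N x = ∀ i → ∣ x i ∣ ^ (2 * n) ≤ N ^ (2 * n ∸ 1)

-- Take L minimal with N ≤ L^{2n} and S minimal with N ≤ L (S + 1),
-- and cut [0, N) into L intervals of length S + 1. The N residue vectors (k a mod N), 0 ≤ k < N,
-- lie in L^n < N boxes, so two of them, for k ≠ k', share a box. Their difference lies in S_a,
-- has entries of absolute value at most S, and S^{2n} N ≤ (S L)^{2n} < N^{2n}. It is non-zero:
-- otherwise N divides (k - k') aᵢ for every i, hence N divides k - k' as gcd(a, N) = 1.
module Submission where

open import Defs
open import Data.Nat as ℕ
  using (ℕ; zero; suc; _+_; _*_; _^_; _∸_; _≤_; _<_; _≤?_; _/_; _%_; ∣_-_∣; z≤n; s≤s)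
  using (NonZero; >-nonZero; >-nonZero⁻¹)
open import Data.Nat.Properties
open import Data.Nat.DivMod using (m≡m%n+[m/n]*n; m%n<n; m<n*o⇒m/o<n)
open import Data.Nat.Divisibility using (_∣_; divides; n∣m*n; >⇒∤)
open import Data.Nat.GCD using (c*gcd[m,n]≡gcd[cm,cn]; gcd-greatest)
open import Data.Integer as ℤ using (ℤ; +_; ∣_∣)
import Data.Integer.Properties as ℤ
open import Data.Integer.DivMod using (_%ℕ_; _/ℕ_; a≡a%ℕn+[a/ℕn]*n; n%ℕd<d)
open import Data.Integer.Tactic.RingSolver using (solve-∀)
open import Data.Fin as Fin using (Fin; toℕ; fromℕ<; funToFin; finToFun)
import Data.Fin.Properties as Fin
open import Data.Vec.Functional using (Vector; head; tail)
open import Data.Product using (∃; ∃₂; _×_; _,_)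
open import Data.Sum using (inj₁; inj₂)
open import Function using (_∘_)
open import Relation.Nullary using (¬_; yes; no; contradiction)
open import Relation.Binary.PropositionalEquality
  using (_≡_; _≢_; refl; sym; trans; cong; cong₂; subst; module ≡-Reasoning)
open import Algebra.Properties.CommutativeSemigroup *-commutativeSemigroup using (interchange)

threshold-crossing : ∀ (f : ℕ → ℕ) {N} m → f 0 < N → N ≤ f m → ∃ λ k → f k < N × N ≤ f (suc k)
threshold-crossing f zero f0<N N≤f0 = contradiction N≤f0 (<⇒≱ f0<N)
threshold-crossing f (suc m) f0<N N≤f[1+m] with _ ≤? f m
... | yes N≤fm = threshold-crossing f m f0<N N≤fm
... | no  N≰fm = m , ≰⇒> N≰fm , N≤f[1+m]

∣[+m]-[+n]∣≡∣m-n∣ : ∀ m n → ∣ + m ℤ.- + n ∣ ≡ ∣ m - n ∣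
∣[+m]-[+n]∣≡∣m-n∣ m n with ≤-total m n
... | inj₁ m≤n = begin
  ∣ + m ℤ.- + n ∣ ≡⟨ cong ∣_∣ (ℤ.[+m]-[+n]≡m⊖n m n) ⟩
  ∣ m ℤ.⊖ n ∣     ≡⟨ ℤ.∣⊖∣-≤ m≤n ⟩
  n ∸ m           ≡⟨ m≤n⇒∣m-n∣≡n∸m m≤n ⟨
  ∣ m - n ∣       ∎
  where open ≡-Reasoning
... | inj₂ n≤m = begin
  ∣ + m ℤ.- + n ∣ ≡⟨ ℤ.∣i-j∣≡∣j-i∣ (+ m) (+ n) ⟩
  ∣ + n ℤ.- + m ∣ ≡⟨ cong ∣_∣ (ℤ.[+m]-[+n]≡m⊖n n m) ⟩
  ∣ n ℤ.⊖ m ∣     ≡⟨ ℤ.∣⊖∣-≤ n≤m ⟩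
  m ∸ n           ≡⟨ m≤n⇒∣n-m∣≡n∸m n≤m ⟨
  ∣ m - n ∣       ∎
  where open ≡-Reasoning

m/d≡n/d⇒∣m-n∣<d : ∀ m n d .{{_ : NonZero d}} → m / d ≡ n / d → ∣ m - n ∣ < d
m/d≡n/d⇒∣m-n∣<d m n d eq = begin-strict
  ∣ m - n ∣                                   ≡⟨ cong₂ ∣_-_∣ (m≡m%n+[m/n]*n m d) (m≡m%n+[m/n]*n n d) ⟩
  ∣ m % d + m / d * d - n % d + n / d * d ∣   ≡⟨ cong (λ q → ∣ m % d + q * d - n % d + n / d * d ∣) eq ⟩
  ∣ m % d + n / d * d - n % d + n / d * d ∣   ≡⟨ cong₂ ∣_-_∣ (+-comm (m % d) _) (+-comm (n % d) _) ⟩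
  ∣ n / d * d + m % d - n / d * d + n % d ∣   ≡⟨ ∣m+n-m+o∣≡∣n-o∣ (n / d * d) (m % d) (n % d) ⟩
  ∣ m % d - n % d ∣                           ≤⟨ ∣m-n∣≤m⊔n (m % d) (n % d) ⟩
  m % d ℕ.⊔ n % d                             <⟨ ⊔-pres-<m (m%n<n m d) (m%n<n n d) ⟩
  d                                           ∎
  where open ≤-Reasoning

%ℕ-sub : ∀ A B N .{{_ : NonZero N}} →
         + (A %ℕ N) ℤ.- + (B %ℕ N) ≡ (A ℤ.- B) ℤ.+ + N ℤ.* (B /ℕ N ℤ.- A /ℕ N)
%ℕ-sub A B N = begin
  rA ℤ.- rB
    ≡⟨ regroup rA rB (A /ℕ N) (B /ℕ N) (+ N) ⟩
  (rA ℤ.+ A /ℕ N ℤ.* + N) ℤ.- (rB ℤ.+ B /ℕ N ℤ.* + N) ℤ.+ y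
    ≡⟨ cong₂ (λ A′ B′ → A′ ℤ.- B′ ℤ.+ y) (a≡a%ℕn+[a/ℕn]*n A N) (a≡a%ℕn+[a/ℕn]*n B N) ⟨
  A ℤ.- B ℤ.+ y
    ∎
  where
  open ≡-Reasoning
  rA = + (A %ℕ N)
  rB = + (B %ℕ N)
  y = + N ℤ.* (B /ℕ N ℤ.- A /ℕ N)
  regroup : ∀ r s p q n → r ℤ.- s ≡ (r ℤ.+ p ℤ.* n) ℤ.- (s ℤ.+ q ℤ.* n) ℤ.+ n ℤ.* (q ℤ.- p)
  regroup = solve-∀

^-distribʳ-* : ∀ m n e → (m * n) ^ e ≡ m ^ e * n ^ e
^-distribʳ-* m n zero    = refl
^-distribʳ-* m n (suc e) = begin
  m * n * (m * n) ^ e     ≡⟨ cong (m * n *_) (^-distribʳ-* m n e) ⟩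
  m * n * (m ^ e * n ^ e) ≡⟨ interchange m n (m ^ e) (n ^ e) ⟩
  m ^ suc e * n ^ suc e   ∎
  where open ≡-Reasoning

∣-*-gcdWith : ∀ {n} (a : Vector ℤ n) d N → (∀ l → N ∣ d * ∣ a l ∣) → N ∣ d * gcdWith a N
∣-*-gcdWith {zero}  a d N _    = n∣m*n d
∣-*-gcdWith {suc n} a d N N∣da =
  subst (N ∣_) (sym (c*gcd[m,n]≡gcd[cm,cn] d ∣ head a ∣ (gcdWith (tail a) N)))
    (gcd-greatest (N∣da Fin.zero) (∣-*-gcdWith (tail a) d N (N∣da ∘ Fin.suc)))

∣∣m-n∣⇒m≡n : ∀ {m n N} → m < N → n < N → N ∣ ∣ m - n ∣ → m ≡ n
∣∣m-n∣⇒m≡n {m} {n} {N} m<N n<N N∣∣m-n∣ with ∣ m - n ∣ in eq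
... | zero  = ∣m-n∣≡0⇒m≡n eq
... | suc _ = contradiction N∣∣m-n∣ (>⇒∤ (subst (_< N) eq ∣m-n∣<N))
  where
  ∣m-n∣<N : ∣ m - n ∣ < N
  ∣m-n∣<N = ≤-<-trans (∣m-n∣≤m⊔n m n) (⊔-pres-<m m<N n<N)

i+N*j≡0⇒N∣∣i∣ : ∀ i N j → i ℤ.+ + N ℤ.* j ≡ ℤ.0ℤ → N ∣ ∣ i ∣
i+N*j≡0⇒N∣∣i∣ i N j eq = divides ∣ j ∣ (begin
  ∣ i ∣                ≡⟨ cong ∣_∣ i≡-N*j ⟩
  ∣ ℤ.- (+ N ℤ.* j) ∣  ≡⟨ ℤ.∣-i∣≡∣i∣ (+ N ℤ.* j) ⟩
  ∣ + N ℤ.* j ∣        ≡⟨ ℤ.abs-* (+ N) j ⟩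
  N * ∣ j ∣            ≡⟨ *-comm N ∣ j ∣ ⟩
  ∣ j ∣ * N            ∎)
  where
  open ≡-Reasoning
  i≡-N*j : i ≡ ℤ.- (+ N ℤ.* j)
  i≡-N*j = ℤ.i-j≡0⇒i≡j i _ (trans (cong (ℤ._+_ i) (ℤ.neg-involutive _)) eq)

pigeonhole-boxes : ∀ {n L N} m .{{_ : NonZero m}} → L ^ n < N → (v : Fin N → Vector ℕ n) →
                   (∀ k l → v k l < L * m) → ∃₂ λ i j → i ≢ j × ∀ l → v i l / m ≡ v j l / m
pigeonhole-boxes {n} {L} {N} m Lⁿ<N v v<Lm =
  let i , j , i<j , same-code = Fin.pigeonhole Lⁿ<N (funToFin ∘ box)
  in  i , j , Fin.<⇒≢ i<j , same-box same-code
  where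
  box : Fin N → Fin n → Fin L
  box k l = fromℕ< (m<n*o⇒m/o<n (v<Lm k l))
  same-box : ∀ {i j} → funToFin (box i) ≡ funToFin (box j) → ∀ l → v i l / m ≡ v j l / m
  same-box {i} {j} same-code l = begin
    v i l / m                           ≡⟨ Fin.toℕ-fromℕ< _ ⟨
    toℕ (box i l)                       ≡⟨ cong toℕ (Fin.finToFun-funToFin (box i) l) ⟨
    toℕ (finToFun (funToFin (box i)) l) ≡⟨ cong (λ c → toℕ (finToFun c l)) same-code ⟩
    toℕ (finToFun (funToFin (box j)) l) ≡⟨ cong toℕ (Fin.finToFun-funToFin (box j) l) ⟩
    toℕ (box j l)                       ≡⟨ Fin.toℕ-fromℕ< _ ⟩
    v j l / m                           ∎
    where open ≡-Reasoning

∃-root-bracket : ∀ e .{{_ : NonZero e}} N .{{_ : NonZero N}} → ∃ λ K → K ^ e < N × N ≤ suc K ^ e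
∃-root-bracket e@(suc e′) N =
  threshold-crossing (_^ e) N (>-nonZero⁻¹ N) (m≤m*n N (N ^ e′) {{m^n≢0 N e′}})

∃-ceiling-quotient : ∀ L .{{_ : NonZero L}} N .{{_ : NonZero N}} → ∃ λ S → L * S < N × N ≤ L * suc S
∃-ceiling-quotient L N =
  threshold-crossing (L *_) N (subst (_< N) (sym (*-zeroʳ L)) (>-nonZero⁻¹ N)) (m≤n*m N L)

-- For m ≥ 2 this is (m + 1)^n ≤ m^{2n}; the cases m ≤ 1 are where 2^{2n} < o is needed.
1+m^n<o : ∀ m n {o} → m ^ (2 * n) < o → 2 ^ (2 * n) < o → suc m ^ n < o
1+m^n<o zero            n _ 2²ⁿ<o =
  ≤-<-trans (subst (_≤ 2 ^ (2 * n)) (sym (^-zeroˡ n)) (m^n>0 2 (2 * n))) 2²ⁿ<o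
1+m^n<o (suc zero)      n _ 2²ⁿ<o =
  ≤-<-trans (^-monoʳ-≤ 2 (m≤m+n n (1 * n))) 2²ⁿ<o
1+m^n<o m@(suc (suc _)) n m²ⁿ<o _ = begin-strict
  suc m ^ n       ≤⟨ ^-monoˡ-≤ n m<m² ⟩
  (m ^ 2) ^ n     ≡⟨ ^-*-assoc m 2 n ⟩
  m ^ (2 * n)     <⟨ m²ⁿ<o ⟩
  _               ∎
  where
  open ≤-Reasoning
  m<m² : m < m ^ 2
  m<m² = subst (m <_) (cong (m *_) (sym (*-identityʳ m))) (m<m*n m m (s≤s (s≤s z≤n)))

L*S<N≤Lᵉ⇒Sᵉ≤Nᵉ⁻¹ : ∀ e .{{_ : NonZero e}} {L S N} → L * S < N → N ≤ L ^ e → S ^ e ≤ N ^ (e ∸ 1)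
L*S<N≤Lᵉ⇒Sᵉ≤Nᵉ⁻¹ e@(suc e′) {L} {S} {N} LS<N N≤Lᵉ =
  *-cancelʳ-≤ (S ^ e) (N ^ e′) N {{>-nonZero (≤-<-trans z≤n LS<N)}} (begin
  S ^ e * N        ≤⟨ *-monoʳ-≤ (S ^ e) N≤Lᵉ ⟩
  S ^ e * L ^ e    ≡⟨ ^-distribʳ-* S L e ⟨
  (S * L) ^ e      ≤⟨ ^-monoˡ-≤ e (<⇒≤ (subst (_< N) (*-comm L S) LS<N)) ⟩
  N ^ e            ≡⟨ *-comm N (N ^ e′) ⟩
  N ^ e′ * N       ∎)
  where open ≤-Reasoning

grid-parameters : ∀ n .{{_ : NonZero n}} N → 2 ^ (2 * n) < N →
                  ∃₂ λ L S → L ^ n < N × N ≤ L * suc S × S ^ (2 * n) ≤ N ^ (2 * n ∸ 1)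
grid-parameters n@(suc _) N 2²ⁿ<N =
  let instance N≢0 = >-nonZero (≤-<-trans z≤n 2²ⁿ<N)
      K , K²ⁿ<N , N≤L²ⁿ = ∃-root-bracket (2 * n) N
      S , LS<N , N≤L[1+S] = ∃-ceiling-quotient (suc K) N
  in  suc K , S , 1+m^n<o K n K²ⁿ<N 2²ⁿ<N , N≤L[1+S] , L*S<N≤Lᵉ⇒Sᵉ≤Nᵉ⁻¹ (2 * n) LS<N N≤L²ⁿ

kaMod : ∀ {n} N .{{_ : NonZero N}} → Vector ℤ n → ℤ → Vector ℕ n
kaMod N a k l = (k ℤ.* a l) %ℕ N

diff : ∀ {n} → Vector ℕ n → Vector ℕ n → Vector ℤ n
diff v w l = + v l ℤ.- + w l

%ℕ-sub-* : ∀ t u a N .{{_ : NonZero N}} → + ((t ℤ.* a) %ℕ N) ℤ.- + ((u ℤ.* a) %ℕ N) ≡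
           (t ℤ.- u) ℤ.* a ℤ.+ + N ℤ.* ((u ℤ.* a) /ℕ N ℤ.- (t ℤ.* a) /ℕ N)
%ℕ-sub-* t u a N = trans (%ℕ-sub (t ℤ.* a) (u ℤ.* a) N) (cong (ℤ._+ y) (factor t u a))
  where
  y = + N ℤ.* ((u ℤ.* a) /ℕ N ℤ.- (t ℤ.* a) /ℕ N)
  factor : ∀ t u a → t ℤ.* a ℤ.- u ℤ.* a ≡ (t ℤ.- u) ℤ.* a
  factor = solve-∀

module _ {n} (N : ℕ) .{{_ : NonZero N}} (a : Vector ℤ n) where

  diff-kaMod-∈S : ∀ t u → InS a N (diff (kaMod N a t) (kaMod N a u))
  diff-kaMod-∈S t u =
    t ℤ.- u , (λ l → (u ℤ.* a l) /ℕ N ℤ.- (t ℤ.* a l) /ℕ N) , λ l → %ℕ-sub-* t u (a l) N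

  diff-kaMod-nonZero : gcdWith a N ≡ 1 → ∀ {t u} → t < N → u < N → t ≢ u →
                       NonZeroVec (diff (kaMod N a (+ t)) (kaMod N a (+ u)))
  diff-kaMod-nonZero gcd≡1 {t} {u} t<N u<N t≢u =
    Fin.¬∀⟶∃¬ n _ (λ l → diff (kaMod N a (+ t)) (kaMod N a (+ u)) l ℤ.≟ ℤ.0ℤ) all-zero⇒t≡u
    where
    all-zero⇒t≡u : ¬ (∀ l → diff (kaMod N a (+ t)) (kaMod N a (+ u)) l ≡ ℤ.0ℤ)
    all-zero⇒t≡u x≡0 =
      t≢u (∣∣m-n∣⇒m≡n t<N u<N (subst (N ∣_) d*gcd≡∣t-u∣ (∣-*-gcdWith a d N N∣d*aₗ)))
      where
      d = ∣ + t ℤ.- + u ∣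
      d*gcd≡∣t-u∣ : d * gcdWith a N ≡ ∣ t - u ∣
      d*gcd≡∣t-u∣ = trans (cong (d *_) gcd≡1) (trans (*-identityʳ d) (∣[+m]-[+n]∣≡∣m-n∣ t u))
      N∣d*aₗ : ∀ l → N ∣ d * ∣ a l ∣
      N∣d*aₗ l = subst (N ∣_) (ℤ.abs-* (+ t ℤ.- + u) (a l))
        (i+N*j≡0⇒N∣∣i∣ ((+ t ℤ.- + u) ℤ.* a l) N _
          (trans (sym (%ℕ-sub-* (+ t) (+ u) (a l) N)) (x≡0 l)))

diff-∈ball : ∀ {n} N S {v w : Vector ℕ n} → (∀ l → v l / suc S ≡ w l / suc S) →
             S ^ (2 * n) ≤ N ^ (2 * n ∸ 1) → InBall n N (diff v w)
diff-∈ball {n} N S {v} {w} same-box Sᵉ≤ l = begin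
  ∣ diff v w l ∣ ^ (2 * n) ≡⟨ cong (_^ (2 * n)) (∣[+m]-[+n]∣≡∣m-n∣ (v l) (w l)) ⟩
  ∣ v l - w l ∣ ^ (2 * n)  ≤⟨ ^-monoˡ-≤ (2 * n) ∣vₗ-wₗ∣≤S ⟩
  S ^ (2 * n)              ≤⟨ Sᵉ≤ ⟩
  N ^ (2 * n ∸ 1)          ∎
  where
  open ≤-Reasoning
  ∣vₗ-wₗ∣≤S : ∣ v l - w l ∣ ≤ S
  ∣vₗ-wₗ∣≤S = ℕ.s≤s⁻¹ (m/d≡n/d⇒∣m-n∣<d (v l) (w l) (suc S) (same-box l))

lemma1 : (n : ℕ) → 1 ≤ n → (N : ℕ) → 2 ^ (2 * n) + 1 ≤ N →
    (a : Vector ℤ n) → NonZeroVec a → gcdWith a N ≡ 1 →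
    ∃ λ (x : Vector ℤ n) → InS a N x × NonZeroVec x × InBall n N x
lemma1 n _ zero 2²ⁿ+1≤N _ _ _ with () ← m+n≤o⇒n≤o (2 ^ (2 * n)) 2²ⁿ+1≤N
lemma1 n@(suc _) _ N@(suc _) 2²ⁿ+1≤N a _ gcd≡1 =
  let 2²ⁿ<N = subst (_≤ N) (+-comm (2 ^ (2 * n)) 1) 2²ⁿ+1≤N
      L , S , Lⁿ<N , N≤L[1+S] , Sᵉ≤ = grid-parameters n N 2²ⁿ<N
      i , j , i≢j , same-box = pigeonhole-boxes (suc S) Lⁿ<N (kaMod N a ∘ +_ ∘ toℕ)
                                 (λ k l → <-≤-trans (n%ℕd<d (+ toℕ k ℤ.* a l) N) N≤L[1+S])
  in  diff (kaMod N a (+ toℕ i)) (kaMod N a (+ toℕ j))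
    , diff-kaMod-∈S N a (+ toℕ i) (+ toℕ j)
    , diff-kaMod-nonZero N a gcd≡1 (Fin.toℕ<n i) (Fin.toℕ<n j) (i≢j ∘ Fin.toℕ-injective)
    , diff-∈ball N S {kaMod N a (+ toℕ i)} {kaMod N a (+ toℕ j)} same-box Sᵉ≤
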